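{- Consider the Bruck–Bose representation of $\mathrm{PG}(2,q^3)$ in $\mathrm{PG}(6,q)$ with respect to a line at infinity $\ell_\infty$ of Type I. Then the set of all affine I-points and affine II-points of $\mathrm{PG}(6,q)$ is precisely the set of affine points of a quadric of $\mathrm{PG}(6,q)$ which is degenerate, with vertex the plane $\pi_{\mathrm{fix}}$ and base a non-singular hyperbolic quadric of a 3-space disjoint from $\pi_{\mathrm{fix}}$.
   Context: Let $q>2$ be a prime power. Let $\phi$ be a collineation of $\mathrm{PG}(2,q^3)$ of order 3 fixing pointwise an $\mathbb F_q$-subplane $\mathcal P_{2,q}$. A point $\bar P$ of $\mathrm{PG}(2,q^3)$ has Type I if it lies in $\mathcal P_{2,q}$, Type II if $\bar P,\bar P^\phi,\bar P^{\phi^2}$ are distinct and collinear, and Type III if they are non-collinear; a line has Type I if it meets $\mathcal P_{2,q}$ in $q+1$ points. Bruck–Bose representation: fix a basis $1,\tau,\tau^2$ of $\mathbb F_{q^3}$ over $\mathbb F_q$ and let $\theta(x_0+x_1\tau+x_2\tau^2)=(x_0,x_1,x_2)$. Choose coordinates so that $\ell_\infty$ is $z=0$. The affine point $\bar P=(x,y,1)$ of $\mathrm{PG}(2,q^3)$ corresponds to the point $[P]=(\theta(x),\theta(y),1)$ of $\mathrm{PG}(6,q)$, not in the hyperplane $\Sigma_\infty$ (last coordinate $0$); affine points of $\mathrm{PG}(6,q)$ are those not in $\Sigma_\infty$. An affine point $[P]$ is called an X-point ($X\in\{$I,II,III$\}$) if $\bar P$ has Type X. $\pi_{\mathrm{fix}}$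 denotes the plane of $\mathrm{PG}(6,q)$ representing $\mathcal P_{2,q}$, i.e. the plane whose affine points are exactly the points $[P]$ with $\bar P$ an affine point of $\mathcal P_{2,q}$. -}

module Defs where

open import Level using (0ℓ)
open import Data.Nat using (ℕ; zero; suc; _≤_; _^_)
open import Data.Nat.Primality using (Prime)
open import Data.Fin using (Fin; zero; suc)
open import Data.Product using (Σ; ∃; _×_; _,_)
open import Data.Sum using (_⊎_)
open import Relation.Nullary using (¬_)
open import Relation.Binary.PropositionalEquality using (_≡_)
open import Algebra.Bundles using (CommutativeRing)
open import Algebra.Morphism.Structures using (module RingMorphisms)

IsPrimePower : ℕ → Set
IsPrimePower q = ∃ λ p → ∃ λ k → Prime p × (1 ≤ k) × (q ≡ p ^ k)

record Field : Set₁ where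
  field
    ring : CommutativeRing 0ℓ 0ℓ
  open CommutativeRing ring hiding (zero)
  field
    1≉0 : ¬ (1# ≈ 0#)
    inverse : ∀ x → ¬ (x ≈ 0#) → ∃ λ y → (x * y) ≈ 1#

module FieldOps (F : Field) where
  open CommutativeRing (Field.ring F) public hiding (zero)

  HasCard : ℕ → Set
  HasCard n = Σ (Fin n → Carrier) λ e →
    (∀ i j → e i ≈ e j → i ≡ j) × (∀ x → ∃ λ i → e i ≈ x)

  pow : Carrier → ℕ → Carrier
  pow x zero = 1#
  pow x (suc n) = x * pow x n

  sumF : ∀ {n} → (Fin n → Carrier) → Carrier
  sumF {zero} f = 0#
  sumF {suc n} f = f zero + sumF (λ i → f (suc i))

  Vect : ℕ → Set
  Vect m = Fin m → Carrier

  _≈v_ : ∀ {m} → Vect m → Vect m → Set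
  u ≈v v = ∀ i → u i ≈ v i

  0v : ∀ {m} → Vect m
  0v i = 0#

  _+v_ : ∀ {m} → Vect m → Vect m → Vect m
  (u +v v) i = u i + v i

  comb : ∀ {m n} → (Fin n → Carrier) → (Fin n → Vect m) → Vect m
  comb w e i = sumF (λ j → w j * e j i)

  Independent : ∀ {m n} → (Fin n → Vect m) → Set
  Independent e = ∀ w → comb w e ≈v 0v → ∀ j → w j ≈ 0#

  InSpan : ∀ {m n} → (Fin n → Vect m) → Vect m → Set
  InSpan e v = ∃ λ w → comb w e ≈v v

  SameSpan : ∀ {m n k} → (Fin n → Vect m) → (Fin k → Vect m) → Set
  SameSpan e f = ∀ v → (InSpan e v → InSpan f v) × (InSpan f v → InSpan e v)

  QForm : ℕ → Set
  QForm m = Fin m → Fin m → Carrier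

  evalQ : ∀ {m} → QForm m → Vect m → Carrier
  evalQ c v = sumF (λ i → sumF (λ j → c i j * (v i * v j)))

  -- projective points: nonzero vectors; same point: proportional
  NonZero : ∀ {m} → Vect m → Set
  NonZero v = ¬ (v ≈v 0v)

  SamePoint : ∀ {m} → Vect m → Vect m → Set
  SamePoint u v = ∃ λ λ' → ¬ (λ' ≈ 0#) × (∀ i → u i ≈ (λ' * v i))

  Collinear : Vect 3 → Vect 3 → Vect 3 → Set
  Collinear u v w = ∃ λ (l : Vect 3) → NonZero l ×
    (sumF (λ i → l i * u i) ≈ 0#) ×
    (sumF (λ i → l i * v i) ≈ 0#) ×
    (sumF (λ i → l i * w i) ≈ 0#)

  -- The quadric {Q = 0} of PG(6,F) is degenerate, with vertex the plane
  -- spanned by the family p, and base a non-singular hyperbolic quadric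
  -- Q⁺(3,F) (canonical form x0 x1 + x2 x3) of a 3-space Σ = ⟨s⟩
  -- disjoint from the vertex: in coordinates adapted to the
  -- decomposition F^7 = ⟨s⟩ ⊕ ⟨r⟩ (r a basis of the vertex plane),
  -- Q(Σ a_i s_i + Σ b_j r_j) = a0 a1 + a2 a3.
  ConeOverHyperbolic : QForm 7 → (Fin 3 → Vect 7) → Set
  ConeOverHyperbolic c p =
    Σ (Fin 4 → Vect 7) λ s → Σ (Fin 3 → Vect 7) λ r →
      -- s ∪ r independent: ⟨s⟩ is a 3-space, ⟨r⟩ a plane, disjoint
      Independent {7} {7} (λ { zero → s zero ; (suc zero) → s (suc zero)
                           ; (suc (suc zero)) → s (suc (suc zero))
                           ; (suc (suc (suc zero))) → s (suc (suc (suc zero)))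
                           ; (suc (suc (suc (suc j)))) → r j }) ×
      SameSpan r p ×
      (∀ (a : Fin 4 → Carrier) (b : Fin 3 → Carrier) →
         evalQ c (comb a s +v comb b r)
           ≈ ((a zero * a (suc zero))
              + (a (suc (suc zero)) * a (suc (suc (suc zero))))))

-- The setting: F = GF(q) embedded in K = GF(q^3) via ι,
-- σ an automorphism of K of order 3 fixing ι(F) pointwise
-- (the collineation φ : (x,y,z) ↦ (x^σ,y^σ,z^σ)),
-- τ ∈ K with 1, τ, τ² an F-basis of K.

module Setup (F K : Field) (ι : FieldOps.Carrier F → FieldOps.Carrier K)
             (σ : FieldOps.Carrier K → FieldOps.Carrier K)
             (τ : FieldOps.Carrier K) where
  module FF = FieldOps F
  module KK = FieldOps K
  open RingMorphisms using (IsRingHomomorphism)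

  IsEmbedding : Set
  IsEmbedding = IsRingHomomorphism FF.rawRing KK.rawRing ι

  IsOrder3AutFixingSubfield : Set
  IsOrder3AutFixingSubfield =
    IsRingHomomorphism KK.rawRing KK.rawRing σ ×
    (∀ x → σ (σ (σ x)) KK.≈ x) ×
    (∃ λ x → ¬ (σ x KK.≈ x)) ×
    (∀ a → σ (ι a) KK.≈ ι a)

  θ⁻¹ : FF.Carrier → FF.Carrier → FF.Carrier → KK.Carrier
  θ⁻¹ a0 a1 a2 = ι a0 KK.+ ((ι a1 KK.* τ) KK.+ (ι a2 KK.* (τ KK.* τ)))

  IsTauBasis : Set
  IsTauBasis =
    (∀ a0 a1 a2 → θ⁻¹ a0 a1 a2 KK.≈ KK.0# →
       (a0 FF.≈ FF.0#) × (a1 FF.≈ FF.0#) × (a2 FF.≈ FF.0#)) ×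
    (∀ x → ∃ λ a0 → ∃ λ a1 → ∃ λ a2 → θ⁻¹ a0 a1 a2 KK.≈ x)

  φ : KK.Vect 3 → KK.Vect 3
  φ v i = σ (v i)

  TypeI : KK.Vect 3 → Set
  TypeI v = ∃ λ (w : FF.Vect 3) → KK.SamePoint v (λ i → ι (w i))

  Distinct3 : KK.Vect 3 → KK.Vect 3 → KK.Vect 3 → Set
  Distinct3 u v w = ¬ KK.SamePoint u v × ¬ KK.SamePoint u w × ¬ KK.SamePoint v w

  TypeII : KK.Vect 3 → Set
  TypeII v = Distinct3 v (φ v) (φ (φ v)) × KK.Collinear v (φ v) (φ (φ v))

  -- Bruck–Bose: the point (θ(x),θ(y),1)·c of PG(6,q), c ≠ 0, corresponds
  -- to (x,y,1) of PG(2,q^3); ℓ∞ : z = 0, Σ∞ : last coordinate 0.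
  -- For v = (v0,…,v6) we return the representative
  -- (θ⁻¹(v0,v1,v2), θ⁻¹(v3,v4,v5), v6) of the corresponding point.
  bb : FF.Vect 7 → KK.Vect 3
  bb v zero = θ⁻¹ (v zero) (v (suc zero)) (v (suc (suc zero)))
  bb v (suc zero) = θ⁻¹ (v (suc (suc (suc zero)))) (v (suc (suc (suc (suc zero)))))
                       (v (suc (suc (suc (suc (suc zero))))))
  bb v (suc (suc _)) = ι (v (suc (suc (suc (suc (suc (suc zero)))))))

  Affine : FF.Vect 7 → Set
  Affine v = ¬ (v (suc (suc (suc (suc (suc (suc zero)))))) FF.≈ FF.0#)

module Submission where

-- In coordinates, an affine point v = (x₀, …, x₆) of PG(6,q) (x₆ ≠ 0) represents
-- P = (X, Y, x₆) with X = x₀ + x₁τ + x₂τ² and Y = x₃ + x₄τ + x₅τ².  As σ fixes F,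
-- P^φ and P^φ² are obtained by replacing τ with τ₁ = τ^σ and τ₂ = τ^σ², so a
-- Vandermonde computation gives
--   det (P, P^φ, P^φ²) = x₆ (τ₁ - τ) (τ₂ - τ) (τ₂ - τ₁) (x₁x₅ - x₂x₄).
-- Since σ has order 3 and K = F(τ), the elements τ, τ₁, τ₂ are distinct.  Hence an
-- element X is σ-fixed iff x₁ = x₂ = 0 (a quadratic taking the same value at three
-- points is constant), so P has type I iff v lies on the plane x₁ = x₂ = x₄ = x₅ = 0,
-- and otherwise P, P^φ, P^φ² are distinct and collinear iff x₁x₅ - x₂x₄ = 0.  The
-- form x₁x₅ - x₂x₄ has that plane as its radical, and on the 3-space spanned by
-- e₁, e₅, e₂, -e₄ it is the hyperbolic form a₀a₁ + a₂a₃.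

open import Level using (0ℓ)
open import Algebra.Bundles using (CommutativeRing)
open import Algebra.Bundles.Raw using (RawRing)
open import Algebra.Morphism.Structures using (module RingMorphisms)
open import Data.Empty using (⊥-elim)
open import Data.Fin using (Fin; zero; suc; #_; _↑ˡ_; _↑ʳ_)
open import Data.Fin.Properties using (_≟_)
open import Data.Integer as ℤ using (ℤ; +_; -[1+_]; _⊖_)
import Data.Integer.Properties as ℤ
open import Data.Maybe using (Maybe; just; nothing)
open import Data.Nat as ℕ using (ℕ; zero; suc; _<_; _^_)
import Data.Nat.Properties as ℕ
open import Data.Product using (∃; _×_; _,_; proj₁; proj₂)
open import Data.Sum using (_⊎_; inj₁; inj₂; [_,_])
open import Data.Vec.Functional using (_∷_; []; _++_)
open import Data.Vec.N-ary using (N-ary)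
open import Function using (id; _∘_; case_of_)
open import Relation.Binary.PropositionalEquality as ≡ using (_≡_)
open import Relation.Nullary using (¬_; Dec; yes; no)
open import Defs

module IntegerCoefficients (R : CommutativeRing 0ℓ 0ℓ) where
  open CommutativeRing R
  open import Algebra.Properties.Ring ring using (-‿involutive; -‿distribˡ-*; -‿distribʳ-*; -0#≈0#)
  open import Algebra.Properties.AbelianGroup +-abelianGroup using (⁻¹-∙-comm)
  open import Algebra.Properties.Semiring.Mult.TCOptimised semiring
    using (1+×; ×-homo-+; ×1-homo-*) renaming (_×_ to _·_)
  open import Relation.Binary.Reasoning.Setoid setoid
  import Algebra.Solver.Ring.AlmostCommutativeRing as ACR

  -- With the optimised multiple, fromℤ 0, fromℤ 1 and fromℤ -1 reduce to 0#, 1# and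
  -- - 1#, so the ring constants in a goal agree definitionally with the solver's con.
  fromℤ : ℤ → Carrier
  fromℤ (+ n)    = n · 1#
  fromℤ -[1+ n ] = - (suc n · 1#)

  fromℤ-neg : ∀ i → fromℤ (ℤ.- i) ≈ - fromℤ i
  fromℤ-neg (+ zero)  = sym -0#≈0#
  fromℤ-neg (+ suc n) = refl
  fromℤ-neg -[1+ n ]  = sym (-‿involutive _)

  fromℤ-⊖ : ∀ m n → fromℤ (m ⊖ n) ≈ m · 1# - n · 1#
  fromℤ-⊖ m zero = begin
    m · 1#        ≈⟨ +-identityʳ _ ⟨
    m · 1# + 0#   ≈⟨ +-congˡ -0#≈0# ⟨
    m · 1# - 0#   ∎
  fromℤ-⊖ zero (suc n) = sym (+-identityˡ _)
  fromℤ-⊖ (suc m) (suc n) = begin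
    fromℤ (suc m ⊖ suc n)           ≡⟨ ≡.cong fromℤ (ℤ.[1+m]⊖[1+n]≡m⊖n m n) ⟩
    fromℤ (m ⊖ n)                   ≈⟨ fromℤ-⊖ m n ⟩
    m · 1# - n · 1#                 ≈⟨ [a+b]-[a+c]≈b-c 1# (m · 1#) (n · 1#) ⟨
    (1# + m · 1#) - (1# + n · 1#)   ≈⟨ +-cong (1+× m 1#) (-‿cong (1+× n 1#)) ⟨
    suc m · 1# - suc n · 1#         ∎
    where
    [a+b]-[a+c]≈b-c : ∀ a b c → (a + b) - (a + c) ≈ b - c
    [a+b]-[a+c]≈b-c a b c = begin
      (a + b) - (a + c)     ≈⟨ +-congˡ (⁻¹-∙-comm a c) ⟨
      (a + b) + (- a - c)   ≈⟨ +-assoc a b _ ⟩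
      a + (b + (- a - c))   ≈⟨ +-congˡ (+-assoc b (- a) (- c)) ⟨
      a + ((b - a) - c)     ≈⟨ +-congˡ (+-congʳ (+-comm b (- a))) ⟩
      a + ((- a + b) - c)   ≈⟨ +-congˡ (+-assoc (- a) b (- c)) ⟩
      a + (- a + (b - c))   ≈⟨ +-assoc a (- a) _ ⟨
      (a - a) + (b - c)     ≈⟨ +-congʳ (-‿inverseʳ a) ⟩
      0# + (b - c)          ≈⟨ +-identityˡ _ ⟩
      b - c                 ∎

  fromℤ-+ : ∀ i j → fromℤ (i ℤ.+ j) ≈ fromℤ i + fromℤ j
  fromℤ-+ (+ m)    (+ n)    = ×-homo-+ 1# m n
  fromℤ-+ (+ m)    -[1+ n ] = fromℤ-⊖ m (suc n)
  fromℤ-+ -[1+ m ] (+ n)    = trans (fromℤ-⊖ n (suc m)) (+-comm _ _)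
  fromℤ-+ -[1+ m ] -[1+ n ] = begin
    - (suc (suc (m ℕ.+ n)) · 1#)    ≡⟨ ≡.cong (λ k → - (suc k · 1#)) (ℕ.+-suc m n) ⟨
    - ((suc m ℕ.+ suc n) · 1#)      ≈⟨ -‿cong (×-homo-+ 1# (suc m) (suc n)) ⟩
    - (suc m · 1# + suc n · 1#)     ≈⟨ ⁻¹-∙-comm _ _ ⟨
    - (suc m · 1#) - (suc n · 1#)   ∎

  fromℤ-*-+ : ∀ i n → fromℤ (i ℤ.* + n) ≈ fromℤ i * fromℤ (+ n)
  fromℤ-*-+ (+ m) n = begin
    fromℤ (+ m ℤ.* + n)   ≡⟨ ≡.cong fromℤ (ℤ.pos-* m n) ⟨
    (m ℕ.* n) · 1#        ≈⟨ ×1-homo-* m n ⟩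
    m · 1# * n · 1#       ∎
  fromℤ-*-+ -[1+ m ] n = begin
    fromℤ (-[1+ m ] ℤ.* + n)            ≡⟨ ≡.cong fromℤ (ℤ.neg-distribˡ-* (+ suc m) (+ n)) ⟨
    fromℤ (ℤ.- (+ suc m ℤ.* + n))       ≈⟨ fromℤ-neg (+ suc m ℤ.* + n) ⟩
    - fromℤ (+ suc m ℤ.* + n)           ≈⟨ -‿cong (fromℤ-*-+ (+ suc m) n) ⟩
    - (fromℤ (+ suc m) * fromℤ (+ n))   ≈⟨ -‿distribˡ-* _ _ ⟩
    fromℤ -[1+ m ] * fromℤ (+ n)        ∎

  fromℤ-* : ∀ i j → fromℤ (i ℤ.* j) ≈ fromℤ i * fromℤ j
  fromℤ-* i (+ n)    = fromℤ-*-+ i n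
  fromℤ-* i -[1+ n ] = begin
    fromℤ (i ℤ.* -[1+ n ])          ≡⟨ ≡.cong fromℤ (ℤ.neg-distribʳ-* i (+ suc n)) ⟨
    fromℤ (ℤ.- (i ℤ.* + suc n))     ≈⟨ fromℤ-neg (i ℤ.* + suc n) ⟩
    - fromℤ (i ℤ.* + suc n)         ≈⟨ -‿cong (fromℤ-*-+ i (suc n)) ⟩
    - (fromℤ i * fromℤ (+ suc n))   ≈⟨ -‿distribʳ-* _ _ ⟩
    fromℤ i * fromℤ -[1+ n ]        ∎

  fromℤ-morphism : ℤ.+-*-rawRing ACR.-Raw-AlmostCommutative⟶ ACR.fromCommutativeRing R
  fromℤ-morphism = record
    { ⟦_⟧ = fromℤ ; +-homo = fromℤ-+ ; *-homo = fromℤ-* ; -‿homo = fromℤ-neg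
    ; 0-homo = refl ; 1-homo = refl }

  fromℤ-≟ : ∀ i j → Maybe (fromℤ i ≈ fromℤ j)
  fromℤ-≟ i j with i ℤ.≟ j
  ... | yes ≡.refl = just refl
  ... | no _       = nothing

  open import Algebra.Solver.Ring ℤ.+-*-rawRing (ACR.fromCommutativeRing R) fromℤ-morphism fromℤ-≟ public
    using (solve; _:=_; Polynomial; con; _:+_; _:-_; _:*_; :-_)

  polynomialRing : ℕ → RawRing 0ℓ 0ℓ
  polynomialRing n = record
    { Carrier = Polynomial n ; _≈_ = _≡_
    ; _+_ = _:+_ ; _*_ = _:*_ ; -_ = :-_ ; 0# = con (+ 0) ; 1# = con (+ 1) }

-- Written over a raw ring so that, instantiated at polynomial expressions, the same
-- formulas can be handed to the ring solver.  At a field's raw ring, sumF, comb and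
-- evalQ unfold to the definitions of Defs on every concrete dimension.
module Formulas (R : RawRing 0ℓ 0ℓ) where
  open RawRing R

  infixl 6 _-_
  _-_ : Carrier → Carrier → Carrier
  x - y = x + - y

  quadratic : Carrier → Carrier → Carrier → Carrier → Carrier
  quadratic a₀ a₁ a₂ x = a₀ + (a₁ * x + a₂ * (x * x))

  dot : (Fin 3 → Carrier) → (Fin 3 → Carrier) → Carrier
  dot u v = u (# 0) * v (# 0) + (u (# 1) * v (# 1) + u (# 2) * v (# 2))

  cross : (Fin 3 → Carrier) → (Fin 3 → Carrier) → Fin 3 → Carrier
  cross u v = (u (# 1) * v (# 2) - u (# 2) * v (# 1))
            ∷ (u (# 2) * v (# 0) - u (# 0) * v (# 2))
            ∷ (u (# 0) * v (# 1) - u (# 1) * v (# 0)) ∷ []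

  det : (Fin 3 → Carrier) → (Fin 3 → Carrier) → (Fin 3 → Carrier) → Carrier
  det u v w = dot (cross u v) w

  sumF : ∀ {n} → (Fin n → Carrier) → Carrier
  sumF {zero}  f = 0#
  sumF {suc n} f = f zero + sumF (λ i → f (suc i))

  comb : ∀ {m n} → (Fin n → Carrier) → (Fin n → Fin m → Carrier) → Fin m → Carrier
  comb w e i = sumF (λ j → w j * e j i)

  evalQ : ∀ {m} → (Fin m → Fin m → Carrier) → (Fin m → Carrier) → Carrier
  evalQ c v = sumF (λ i → sumF (λ j → c i j * (v i * v j)))

  δ : ∀ {n} → Fin n → Fin n → Carrier
  δ zero    zero    = 1#
  δ zero    (suc _) = 0#
  δ (suc _) zero    = 0#
  δ (suc i) (suc j) = δ i j

  hyperbolicForm : Fin 7 → Fin 7 → Carrier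
  hyperbolicForm i j = δ (# 1) i * δ (# 5) j - δ (# 2) i * δ (# 4) j

  hyperbolicBasis : Fin 4 → Fin 7 → Carrier
  hyperbolicBasis = δ (# 1) ∷ δ (# 5) ∷ δ (# 2) ∷ (λ i → - δ (# 4) i) ∷ []

module Identities (R : CommutativeRing 0ℓ 0ℓ) where
  open CommutativeRing R
  open IntegerCoefficients R
  open Formulas rawRing hiding (_-_)
  module P {n} = Formulas (polynomialRing n)

  quadratic-difference : ∀ a₀ a₁ a₂ x y →
    quadratic a₀ a₁ a₂ y - quadratic a₀ a₁ a₂ x ≈ (y - x) * (a₁ + a₂ * (x + y))
  quadratic-difference = solve 5 (λ a₀ a₁ a₂ x y →
    P.quadratic a₀ a₁ a₂ y P.- P.quadratic a₀ a₁ a₂ x := (y P.- x) :* (a₁ :+ a₂ :* (x :+ y))) refl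

  det-quadratic-rows : ∀ a₀ a₁ a₂ b₀ b₁ b₂ t x y z →
    det (quadratic a₀ a₁ a₂ x ∷ quadratic b₀ b₁ b₂ x ∷ t ∷ [])
        (quadratic a₀ a₁ a₂ y ∷ quadratic b₀ b₁ b₂ y ∷ t ∷ [])
        (quadratic a₀ a₁ a₂ z ∷ quadratic b₀ b₁ b₂ z ∷ t ∷ [])
    ≈ t * ((y - x) * (z - x) * (z - y)) * (a₁ * b₂ - a₂ * b₁)
  det-quadratic-rows = solve 10 (λ a₀ a₁ a₂ b₀ b₁ b₂ t x y z →
    P.det (P.quadratic a₀ a₁ a₂ x ∷ P.quadratic b₀ b₁ b₂ x ∷ t ∷ [])
          (P.quadratic a₀ a₁ a₂ y ∷ P.quadratic b₀ b₁ b₂ y ∷ t ∷ [])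
          (P.quadratic a₀ a₁ a₂ z ∷ P.quadratic b₀ b₁ b₂ z ∷ t ∷ [])
    := t :* ((y P.- x) :* (z P.- x) :* (z P.- y)) :* (a₁ :* b₂ P.- a₂ :* b₁)) refl

  dot-cross-left : ∀ u v → dot (cross u v) u ≈ 0#
  dot-cross-left u v = solve 6 (λ u₀ u₁ u₂ v₀ v₁ v₂ →
    P.dot (P.cross (u₀ ∷ u₁ ∷ u₂ ∷ []) (v₀ ∷ v₁ ∷ v₂ ∷ [])) (u₀ ∷ u₁ ∷ u₂ ∷ []) := con (+ 0))
    refl (u (# 0)) (u (# 1)) (u (# 2)) (v (# 0)) (v (# 1)) (v (# 2))

  dot-cross-right : ∀ u v → dot (cross u v) v ≈ 0#
  dot-cross-right u v = solve 6 (λ u₀ u₁ u₂ v₀ v₁ v₂ →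
    P.dot (P.cross (u₀ ∷ u₁ ∷ u₂ ∷ []) (v₀ ∷ v₁ ∷ v₂ ∷ [])) (v₀ ∷ v₁ ∷ v₂ ∷ []) := con (+ 0))
    refl (u (# 0)) (u (# 1)) (u (# 2)) (v (# 0)) (v (# 1)) (v (# 2))

  adjugate-equation : Fin 3 → N-ary 12 (Polynomial 12) (Polynomial 12 × Polynomial 12)
  adjugate-equation i u₀ u₁ u₂ v₀ v₁ v₂ w₀ w₁ w₂ l₀ l₁ l₂ =
    P.det u v w :* l i := P.dot l u :* P.cross v w i :+ P.dot l v :* P.cross w u i :+ P.dot l w :* P.cross u v i
    where
    u = u₀ ∷ u₁ ∷ u₂ ∷ []
    v = v₀ ∷ v₁ ∷ v₂ ∷ []
    w = w₀ ∷ w₁ ∷ w₂ ∷ []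
    l = l₀ ∷ l₁ ∷ l₂ ∷ []

  det-adjugate : ∀ u v w l i →
    det u v w * l i ≈ dot l u * cross v w i + dot l v * cross w u i + dot l w * cross u v i
  det-adjugate u v w l zero = solve 12 (adjugate-equation (# 0)) refl
    (u (# 0)) (u (# 1)) (u (# 2)) (v (# 0)) (v (# 1)) (v (# 2))
    (w (# 0)) (w (# 1)) (w (# 2)) (l (# 0)) (l (# 1)) (l (# 2))
  det-adjugate u v w l (suc zero) = solve 12 (adjugate-equation (# 1)) refl
    (u (# 0)) (u (# 1)) (u (# 2)) (v (# 0)) (v (# 1)) (v (# 2))
    (w (# 0)) (w (# 1)) (w (# 2)) (l (# 0)) (l (# 1)) (l (# 2))
  det-adjugate u v w l (suc (suc zero)) = solve 12 (adjugate-equation (# 2)) refl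
    (u (# 0)) (u (# 1)) (u (# 2)) (v (# 0)) (v (# 1)) (v (# 2))
    (w (# 0)) (w (# 1)) (w (# 2)) (l (# 0)) (l (# 1)) (l (# 2))

module FieldProperties (F : Field) where
  open FieldOps F
  open Formulas rawRing using (quadratic; dot; cross; det; δ)
  open Identities (Field.ring F) using (quadratic-difference; dot-cross-left; dot-cross-right; det-adjugate)
  open IntegerCoefficients (Field.ring F) using (solve; _:=_; con; _:+_; _:-_; _:*_)
  open import Algebra.Properties.CommutativeSemigroup +-commutativeSemigroup using (interchange)
  open import Algebra.Properties.Group +-group public
    using () renaming (x∙y⁻¹≈ε⇒x≈y to x-y≈0⇒x≈y; x≈y⇒x∙y⁻¹≈ε to x≈y⇒x-y≈0)
  open import Algebra.Properties.Ring ring using (-‿involutive; -0#≈0#)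
  open import Relation.Binary.Reasoning.Setoid setoid

  HasCard⇒decidable : ∀ {n} → HasCard n → ∀ x y → Dec (x ≈ y)
  HasCard⇒decidable (e , e-injective , e-surjective) x y with e-surjective x | e-surjective y
  ... | i , eᵢ≈x | j , eⱼ≈y with i ≟ j
  ...   | yes ≡.refl = yes (trans (sym eᵢ≈x) eⱼ≈y)
  ...   | no i≢j     = no λ x≈y → i≢j (e-injective i j (trans eᵢ≈x (trans x≈y (sym eⱼ≈y))))

  *-cancelˡ-≈0 : ∀ {x y} → ¬ x ≈ 0# → x * y ≈ 0# → y ≈ 0#
  *-cancelˡ-≈0 {x} {y} x≉0 xy≈0 with Field.inverse F x x≉0
  ... | x⁻¹ , xx⁻¹≈1 = begin
    y               ≈⟨ *-identityˡ y ⟨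
    1# * y          ≈⟨ *-congʳ (trans (sym xx⁻¹≈1) (*-comm x x⁻¹)) ⟩
    (x⁻¹ * x) * y   ≈⟨ *-assoc x⁻¹ x y ⟩
    x⁻¹ * (x * y)   ≈⟨ *-congˡ xy≈0 ⟩
    x⁻¹ * 0#        ≈⟨ zeroʳ x⁻¹ ⟩
    0#              ∎

  *-≉0 : ∀ {x y} → ¬ x ≈ 0# → ¬ y ≈ 0# → ¬ x * y ≈ 0#
  *-≉0 x≉0 y≉0 xy≈0 = y≉0 (*-cancelˡ-≈0 x≉0 xy≈0)

  -x≈0⇒x≈0 : ∀ {x} → - x ≈ 0# → x ≈ 0#
  -x≈0⇒x≈0 {x} -x≈0 = trans (sym (-‿involutive x)) (trans (-‿cong -x≈0) -0#≈0#)

  sumF-cong : ∀ {n} {f g : Fin n → Carrier} → (∀ i → f i ≈ g i) → sumF f ≈ sumF g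
  sumF-cong {zero}  f≈g = refl
  sumF-cong {suc n} f≈g = +-cong (f≈g zero) (sumF-cong (λ i → f≈g (suc i)))

  sumF-zero : ∀ {n} {f : Fin n → Carrier} → (∀ i → f i ≈ 0#) → sumF f ≈ 0#
  sumF-zero {zero}  f≈0 = refl
  sumF-zero {suc n} f≈0 = trans (+-cong (f≈0 zero) (sumF-zero (λ i → f≈0 (suc i)))) (+-identityʳ 0#)

  sumF-+ : ∀ {n} (f g : Fin n → Carrier) → sumF (λ i → f i + g i) ≈ sumF f + sumF g
  sumF-+ {zero}  f g = sym (+-identityʳ 0#)
  sumF-+ {suc n} f g = trans (+-congˡ (sumF-+ (λ i → f (suc i)) (λ i → g (suc i)))) (interchange _ _ _ _)

  sumF-δ : ∀ {n} (k : Fin n) (f : Fin n → Carrier) → sumF (λ j → δ k j * f j) ≈ f k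
  sumF-δ zero    f = trans (+-cong (*-identityˡ _) (sumF-zero (λ i → zeroˡ (f (suc i))))) (+-identityʳ _)
  sumF-δ (suc k) f = trans (+-cong (zeroˡ _) (sumF-δ k (λ i → f (suc i)))) (+-identityˡ _)

  comb-δ : ∀ {m n} (k : Fin n) (e : Fin n → Vect m) → comb (δ k) e ≈v e k
  comb-δ k e i = sumF-δ k (λ j → e j i)

  comb-+ : ∀ {m n} (a b : Fin n → Carrier) (e : Fin n → Vect m) →
    comb (λ j → a j + b j) e ≈v (comb a e +v comb b e)
  comb-+ a b e i = trans (sumF-cong (λ j → distribʳ (e j i) (a j) (b j)))
                         (sumF-+ (λ j → a j * e j i) (λ j → b j * e j i))

  comb-zeroˡ : ∀ {m n} {w : Fin n → Carrier} (e : Fin n → Vect m) {i} →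
    (∀ j → w j ≈ 0#) → comb w e i ≈ 0#
  comb-zeroˡ e {i} w≈0 = sumF-zero (λ j → trans (*-congʳ (w≈0 j)) (zeroˡ (e j i)))

  comb-zeroʳ : ∀ {m n} (w : Fin n → Carrier) (e : Fin n → Vect m) {i} →
    (∀ j → e j i ≈ 0#) → comb w e i ≈ 0#
  comb-zeroʳ w e eᵢ≈0 = sumF-zero (λ j → trans (*-congˡ (eᵢ≈0 j)) (zeroʳ (w j)))

  sumF≈dot : ∀ (l u : Vect 3) → sumF (λ i → l i * u i) ≈ dot l u
  sumF≈dot l u = +-congˡ (+-congˡ (+-identityʳ _))

  cross-cong : ∀ {u u′ v v′} → u ≈v u′ → v ≈v v′ → cross u v ≈v cross u′ v′
  cross-cong u≈ v≈ zero             = +-cong (*-cong (u≈ (# 1)) (v≈ (# 2))) (-‿cong (*-cong (u≈ (# 2)) (v≈ (# 1))))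
  cross-cong u≈ v≈ (suc zero)       = +-cong (*-cong (u≈ (# 2)) (v≈ (# 0))) (-‿cong (*-cong (u≈ (# 0)) (v≈ (# 2))))
  cross-cong u≈ v≈ (suc (suc zero)) = +-cong (*-cong (u≈ (# 0)) (v≈ (# 1))) (-‿cong (*-cong (u≈ (# 1)) (v≈ (# 0))))

  det-cong : ∀ {u u′ v v′ w w′} → u ≈v u′ → v ≈v v′ → w ≈v w′ → det u v w ≈ det u′ v′ w′
  det-cong u≈ v≈ w≈ =
    +-cong (*-cong (c≈ (# 0)) (w≈ (# 0))) (+-cong (*-cong (c≈ (# 1)) (w≈ (# 1))) (*-cong (c≈ (# 2)) (w≈ (# 2))))
    where c≈ = cross-cong u≈ v≈

  det≉0⇒¬Collinear : ∀ {u v w} → ¬ det u v w ≈ 0# → ¬ Collinear u v w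
  det≉0⇒¬Collinear {u} {v} {w} det≉0 (l , l≉0 , l·u≈0 , l·v≈0 , l·w≈0) = l≉0 λ i →
    *-cancelˡ-≈0 det≉0 (begin
      det u v w * l i
        ≈⟨ det-adjugate u v w l i ⟩
      dot l u * cross v w i + dot l v * cross w u i + dot l w * cross u v i
        ≈⟨ +-cong (+-cong (vanish {u} l·u≈0) (vanish {v} l·v≈0)) (vanish {w} l·w≈0) ⟩
      0# + 0# + 0#
        ≈⟨ trans (+-congʳ (+-identityʳ 0#)) (+-identityʳ 0#) ⟩
      0#
        ∎)
    where
    vanish : ∀ {x y} → sumF (λ i → l i * x i) ≈ 0# → dot l x * y ≈ 0#
    vanish {x} {y} l·x≈0 = trans (*-congʳ (trans (sym (sumF≈dot l x)) l·x≈0)) (zeroˡ y)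

  det≈0⇒Collinear : ∀ {u v w} → NonZero (cross u v) → det u v w ≈ 0# → Collinear u v w
  det≈0⇒Collinear {u} {v} {w} u×v≉0 det≈0 =
    cross u v , u×v≉0 ,
    trans (sumF≈dot (cross u v) u) (dot-cross-left u v) ,
    trans (sumF≈dot (cross u v) v) (dot-cross-right u v) ,
    trans (sumF≈dot (cross u v) w) det≈0

  SamePoint⇒affine-≈ : ∀ {u w : Vect 3} {t} → ¬ t ≈ 0# → u (# 2) ≈ t → w (# 2) ≈ t →
    SamePoint u w → u (# 0) ≈ w (# 0) × u (# 1) ≈ w (# 1)
  SamePoint⇒affine-≈ {u} {w} {t} t≉0 u₂≈t w₂≈t (c , _ , u≈cw) = unscaled (# 0) , unscaled (# 1)
    where
    c≈1 : c ≈ 1#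
    c≈1 = x-y≈0⇒x≈y c 1# (*-cancelˡ-≈0 t≉0 (begin
      t * (c - 1#)            ≈⟨ solve 2 (λ t c → t :* (c :- con (+ 1)) := c :* t :- t) refl t c ⟩
      c * t - t               ≈⟨ +-cong (*-congˡ (sym w₂≈t)) (-‿cong (sym u₂≈t)) ⟩
      c * w (# 2) - u (# 2)   ≈⟨ +-congʳ (sym (u≈cw (# 2))) ⟩
      u (# 2) - u (# 2)       ≈⟨ -‿inverseʳ _ ⟩
      0#                      ∎))
    unscaled : ∀ i → u i ≈ w i
    unscaled i = trans (u≈cw i) (trans (*-congʳ c≈1) (*-identityˡ (w i)))

  cross≈0⇒affine-≈ : ∀ {u w : Vect 3} {t} → ¬ t ≈ 0# → u (# 2) ≈ t → w (# 2) ≈ t →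
    cross u w ≈v 0v → u (# 0) ≈ w (# 0) × u (# 1) ≈ w (# 1)
  cross≈0⇒affine-≈ {u} {w} {t} t≉0 u₂≈t w₂≈t u×w≈0 =
    sym (x-y≈0⇒x≈y _ _ w₀-u₀≈0) , x-y≈0⇒x≈y _ _ u₁-w₁≈0
    where
    w₀-u₀≈0 : w (# 0) - u (# 0) ≈ 0#
    w₀-u₀≈0 = *-cancelˡ-≈0 t≉0 (begin
      t * (w (# 0) - u (# 0))     ≈⟨ solve 3 (λ t a b → t :* (b :- a) := t :* b :- a :* t) refl t (u (# 0)) (w (# 0)) ⟩
      t * w (# 0) - u (# 0) * t   ≈⟨ +-cong (*-congʳ (sym u₂≈t)) (-‿cong (*-congˡ (sym w₂≈t))) ⟩
      cross u w (# 1)             ≈⟨ u×w≈0 (# 1) ⟩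
      0#                          ∎)
    u₁-w₁≈0 : u (# 1) - w (# 1) ≈ 0#
    u₁-w₁≈0 = *-cancelˡ-≈0 t≉0 (begin
      t * (u (# 1) - w (# 1))     ≈⟨ solve 3 (λ t a b → t :* (a :- b) := a :* t :- t :* b) refl t (u (# 1)) (w (# 1)) ⟩
      u (# 1) * t - t * w (# 1)   ≈⟨ +-cong (*-congˡ (sym w₂≈t)) (-‿cong (*-congʳ (sym u₂≈t))) ⟩
      cross u w (# 0)             ≈⟨ u×w≈0 (# 0) ⟩
      0#                          ∎)

  quadratic≈constant : ∀ {a₀ a₁ a₂} x → a₁ ≈ 0# → a₂ ≈ 0# → quadratic a₀ a₁ a₂ x ≈ a₀
  quadratic≈constant x a₁≈0 a₂≈0 =
    trans (+-congˡ (trans (+-cong (vanish a₁≈0) (vanish a₂≈0)) (+-identityʳ 0#))) (+-identityʳ _)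
    where
    vanish : ∀ {a y} → a ≈ 0# → a * y ≈ 0#
    vanish {a} {y} a≈0 = trans (*-congʳ a≈0) (zeroˡ y)

  quadratic-constant : ∀ {a₀ a₁ a₂ x y z} → ¬ y ≈ x → ¬ z ≈ x → ¬ z ≈ y →
    quadratic a₀ a₁ a₂ y ≈ quadratic a₀ a₁ a₂ x → quadratic a₀ a₁ a₂ z ≈ quadratic a₀ a₁ a₂ x →
    a₁ ≈ 0# × a₂ ≈ 0#
  quadratic-constant {a₀} {a₁} {a₂} {x} {y} {z} y≉x z≉x z≉y pʸ≈pˣ pᶻ≈pˣ = a₁≈0 , a₂≈0
    where
    slope≈0 : ∀ {w} → ¬ w ≈ x → quadratic a₀ a₁ a₂ w ≈ quadratic a₀ a₁ a₂ x → a₁ + a₂ * (x + w) ≈ 0#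
    slope≈0 {w} w≉x pʷ≈pˣ = *-cancelˡ-≈0 (λ w-x≈0 → w≉x (x-y≈0⇒x≈y w x w-x≈0))
      (trans (sym (quadratic-difference a₀ a₁ a₂ x w)) (x≈y⇒x-y≈0 pʷ≈pˣ))
    a₂≈0 : a₂ ≈ 0#
    a₂≈0 = *-cancelˡ-≈0 (λ z-y≈0 → z≉y (x-y≈0⇒x≈y z y z-y≈0)) (begin
      (z - y) * a₂
        ≈⟨ solve 5 (λ a₁ a₂ x y z → (z :- y) :* a₂ := (a₁ :+ a₂ :* (x :+ z)) :- (a₁ :+ a₂ :* (x :+ y)))
             refl a₁ a₂ x y z ⟩
      (a₁ + a₂ * (x + z)) - (a₁ + a₂ * (x + y))
        ≈⟨ +-cong (slope≈0 z≉x pᶻ≈pˣ) (-‿cong (slope≈0 y≉x pʸ≈pˣ)) ⟩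
      0# - 0#
        ≈⟨ -‿inverseʳ 0# ⟩
      0#
        ∎)
    a₁≈0 : a₁ ≈ 0#
    a₁≈0 = begin
      a₁
        ≈⟨ solve 3 (λ a₁ a₂ s → a₁ := (a₁ :+ a₂ :* s) :- a₂ :* s) refl a₁ a₂ (x + y) ⟩
      (a₁ + a₂ * (x + y)) - a₂ * (x + y)
        ≈⟨ +-cong (slope≈0 y≉x pʸ≈pˣ) (-‿cong (trans (*-congʳ a₂≈0) (zeroˡ _))) ⟩
      0# - 0#
        ≈⟨ -‿inverseʳ 0# ⟩
      0#
        ∎

module HyperbolicCone (F : Field) where
  open FieldOps F
  open Formulas rawRing using (hyperbolicForm; hyperbolicBasis)
  open FieldProperties F using (-x≈0⇒x≈0; comb-zeroˡ; comb-zeroʳ)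
  open IntegerCoefficients (Field.ring F) using (solve; _:=_; Polynomial; con; _:+_; _:-_; _:*_; :-_; polynomialRing)
  open import Relation.Binary.Reasoning.Setoid setoid
  module P {n} = Formulas (polynomialRing n)

  quadric : Vect 7 → Carrier
  quadric v = v (# 1) * v (# 5) - v (# 2) * v (# 4)

  evalQ-hyperbolicForm : ∀ v → evalQ hyperbolicForm v ≈ quadric v
  evalQ-hyperbolicForm v = solve 7 (λ x₀ x₁ x₂ x₃ x₄ x₅ x₆ →
    P.evalQ P.hyperbolicForm (x₀ ∷ x₁ ∷ x₂ ∷ x₃ ∷ x₄ ∷ x₅ ∷ x₆ ∷ []) := x₁ :* x₅ :- x₂ :* x₄)
    refl (v (# 0)) (v (# 1)) (v (# 2)) (v (# 3)) (v (# 4)) (v (# 5)) (v (# 6))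

  record InFixedPlane (v : Vect 7) : Set where
    field
      x₁≈0 : v (# 1) ≈ 0#
      x₂≈0 : v (# 2) ≈ 0#
      x₄≈0 : v (# 4) ≈ 0#
      x₅≈0 : v (# 5) ≈ 0#

  InFixedPlane⇒quadric≈0 : ∀ {v} → InFixedPlane v → quadric v ≈ 0#
  InFixedPlane⇒quadric≈0 {v} fixed = begin
    v (# 1) * v (# 5) - v (# 2) * v (# 4)   ≈⟨ +-cong (*-congʳ x₁≈0) (-‿cong (*-congʳ x₂≈0)) ⟩
    0# * v (# 5) - 0# * v (# 4)             ≈⟨ +-cong (zeroˡ _) (-‿cong (zeroˡ _)) ⟩
    0# - 0#                                 ≈⟨ -‿inverseʳ 0# ⟩
    0#                                      ∎
    where open InFixedPlane fixed

  record HasBaseCoordinates (v : Vect 7) (a : Fin 4 → Carrier) : Set where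
    field
      coordinate₁ : v (# 1) ≈ a (# 0)
      coordinate₅ : v (# 5) ≈ a (# 1)
      coordinate₂ : v (# 2) ≈ a (# 2)
      coordinate₄ : v (# 4) ≈ - a (# 3)

  comb-hyperbolicBasis : ∀ a → HasBaseCoordinates (comb a hyperbolicBasis) a
  comb-hyperbolicBasis a = record
    { coordinate₁ = solve 4 (λ a₀ a₁ a₂ a₃ → comb′ a₀ a₁ a₂ a₃ (# 1) := a₀) refl a₀ a₁ a₂ a₃
    ; coordinate₅ = solve 4 (λ a₀ a₁ a₂ a₃ → comb′ a₀ a₁ a₂ a₃ (# 5) := a₁) refl a₀ a₁ a₂ a₃
    ; coordinate₂ = solve 4 (λ a₀ a₁ a₂ a₃ → comb′ a₀ a₁ a₂ a₃ (# 2) := a₂) refl a₀ a₁ a₂ a₃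
    ; coordinate₄ = solve 4 (λ a₀ a₁ a₂ a₃ → comb′ a₀ a₁ a₂ a₃ (# 4) := :- a₃) refl a₀ a₁ a₂ a₃
    }
    where
    comb′ : ∀ {n} → (a₀ a₁ a₂ a₃ : Polynomial n) → Fin 7 → Polynomial n
    comb′ a₀ a₁ a₂ a₃ = P.comb (a₀ ∷ a₁ ∷ a₂ ∷ a₃ ∷ []) P.hyperbolicBasis
    a₀ = a (# 0)
    a₁ = a (# 1)
    a₂ = a (# 2)
    a₃ = a (# 3)

  front : Vect 7 → Fin 4 → Carrier
  front w j = w (j ↑ˡ 3)

  rear : Vect 7 → Fin 3 → Carrier
  rear w j = w (4 ↑ʳ j)

  module _ (p : Fin 3 → Vect 7) (p-fixed : ∀ j → InFixedPlane (p j)) where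
    open InFixedPlane

    comb-++ : ∀ w i → comb w (hyperbolicBasis ++ p) i ≈ comb (front w) hyperbolicBasis i + comb (rear w) p i
    comb-++ w i = solve 5 (λ A B C D T → A :+ (B :+ (C :+ (D :+ T))) := (A :+ (B :+ (C :+ (D :+ con (+ 0))))) :+ T) refl
      (w (# 0) * hyperbolicBasis (# 0) i) (w (# 1) * hyperbolicBasis (# 1) i)
      (w (# 2) * hyperbolicBasis (# 2) i) (w (# 3) * hyperbolicBasis (# 3) i)
      (comb (rear w) p i)

    ++-independent : Independent p → Independent (hyperbolicBasis ++ p)
    ++-independent p-independent w w·e≈0 = w≈0
      where
      open HasBaseCoordinates (comb-hyperbolicBasis (front w))
      base-coefficient≈0 : ∀ {i x} → comb (front w) hyperbolicBasis i ≈ x → (∀ j → p j i ≈ 0#) → x ≈ 0#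
      base-coefficient≈0 {i} {x} base≈x p≈0 = begin
        x                                                      ≈⟨ trans (sym base≈x) (sym (+-identityʳ _)) ⟩
        comb (front w) hyperbolicBasis i + 0#                  ≈⟨ +-congˡ (comb-zeroʳ (rear w) p p≈0) ⟨
        comb (front w) hyperbolicBasis i + comb (rear w) p i   ≈⟨ comb-++ w i ⟨
        comb w (hyperbolicBasis ++ p) i                        ≈⟨ w·e≈0 i ⟩
        0#                                                     ∎
      front≈0 : ∀ j → front w j ≈ 0#
      front≈0 zero                   = base-coefficient≈0 coordinate₁ (λ j → x₁≈0 (p-fixed j))
      front≈0 (suc zero)             = base-coefficient≈0 coordinate₅ (λ j → x₅≈0 (p-fixed j))
      front≈0 (suc (suc zero))       = base-coefficient≈0 coordinate₂ (λ j → x₂≈0 (p-fixed j))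
      front≈0 (suc (suc (suc zero))) = -x≈0⇒x≈0 (base-coefficient≈0 coordinate₄ (λ j → x₄≈0 (p-fixed j)))
      rear≈0 : ∀ k → rear w k ≈ 0#
      rear≈0 = p-independent (rear w) λ i → begin
        comb (rear w) p i                                      ≈⟨ +-identityˡ _ ⟨
        0# + comb (rear w) p i                                 ≈⟨ +-congʳ (comb-zeroˡ hyperbolicBasis {i} front≈0) ⟨
        comb (front w) hyperbolicBasis i + comb (rear w) p i   ≈⟨ comb-++ w i ⟨
        comb w (hyperbolicBasis ++ p) i                        ≈⟨ w·e≈0 i ⟩
        0#                                                     ∎
      w≈0 : ∀ j → w j ≈ 0#
      w≈0 zero                      = front≈0 (# 0)
      w≈0 (suc zero)                = front≈0 (# 1)
      w≈0 (suc (suc zero))          = front≈0 (# 2)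
      w≈0 (suc (suc (suc zero)))    = front≈0 (# 3)
      w≈0 (suc (suc (suc (suc k)))) = rear≈0 k

    hyperbolicForm-on-cone : ∀ (a : Fin 4 → Carrier) (b : Fin 3 → Carrier) →
      evalQ hyperbolicForm (comb a hyperbolicBasis +v comb b p) ≈ a (# 0) * a (# 1) + a (# 2) * a (# 3)
    hyperbolicForm-on-cone a b = begin
      evalQ hyperbolicForm u
        ≈⟨ evalQ-hyperbolicForm u ⟩
      u (# 1) * u (# 5) - u (# 2) * u (# 4)
        ≈⟨ +-cong (*-cong (off-vertex x₁≈0 coordinate₁) (off-vertex x₅≈0 coordinate₅))
                  (-‿cong (*-cong (off-vertex x₂≈0 coordinate₂) (off-vertex x₄≈0 coordinate₄))) ⟩
      a (# 0) * a (# 1) - a (# 2) * - a (# 3)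
        ≈⟨ solve 4 (λ a₀ a₁ a₂ a₃ → a₀ :* a₁ :- a₂ :* (:- a₃) := a₀ :* a₁ :+ a₂ :* a₃)
             refl (a (# 0)) (a (# 1)) (a (# 2)) (a (# 3)) ⟩
      a (# 0) * a (# 1) + a (# 2) * a (# 3)
        ∎
      where
      open HasBaseCoordinates (comb-hyperbolicBasis a)
      u = comb a hyperbolicBasis +v comb b p
      off-vertex : ∀ {i x} → (∀ {v} → InFixedPlane v → v i ≈ 0#) → comb a hyperbolicBasis i ≈ x → u i ≈ x
      off-vertex vᵢ≈0 base≈x = trans (+-cong base≈x (comb-zeroʳ b p (λ j → vᵢ≈0 (p-fixed j)))) (+-identityʳ _)

    hyperbolic-cone : Independent p → ConeOverHyperbolic hyperbolicForm p
    hyperbolic-cone p-independent =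
      hyperbolicBasis , p , ++-independent p-independent , (λ v → id , id) , hyperbolicForm-on-cone

module BruckBose (F K : Field) (ι : FieldOps.Carrier F → FieldOps.Carrier K)
  (σ : FieldOps.Carrier K → FieldOps.Carrier K) (τ : FieldOps.Carrier K)
  (_≟ꟳ_ : ∀ x y → Dec (FieldOps._≈_ F x y))
  (ι-embedding : Setup.IsEmbedding F K ι σ τ)
  (σ-automorphism : Setup.IsOrder3AutFixingSubfield F K ι σ τ)
  (τ-basis : Setup.IsTauBasis F K ι σ τ) where
  open Setup F K ι σ τ
  open KK
  open Formulas rawRing using (quadratic; cross; det)
  open Formulas FF.rawRing using (δ; hyperbolicForm)
  open Identities (Field.ring K) using (det-quadratic-rows)
  open FieldProperties K
  module F-properties = FieldProperties F
  open HyperbolicCone F using (quadric; evalQ-hyperbolicForm; InFixedPlane; InFixedPlane⇒quadric≈0)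
  open RingMorphisms using (IsRingHomomorphism)
  open import Algebra.Properties.Ring ring using (x[y-z]≈xy-xz)
  open import Relation.Binary.Reasoning.Setoid setoid
  module ιʰ = IsRingHomomorphism ι-embedding
  module σʰ = IsRingHomomorphism (proj₁ σ-automorphism)

  σ-cong : ∀ {x y} → x ≈ y → σ x ≈ σ y
  σ-cong = σʰ.⟦⟧-cong

  σ³≈id : ∀ x → σ (σ (σ x)) ≈ x
  σ³≈id = proj₁ (proj₂ σ-automorphism)

  σ-fixes-ι : ∀ a → σ (ι a) ≈ ι a
  σ-fixes-ι = proj₂ (proj₂ (proj₂ σ-automorphism))

  ι-preserves-≈0 : ∀ {a} → a FF.≈ FF.0# → ι a ≈ 0#
  ι-preserves-≈0 a≈0 = trans (ιʰ.⟦⟧-cong a≈0) ιʰ.0#-homo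

  ι-reflects-≈0 : ∀ {a} → ι a ≈ 0# → a FF.≈ FF.0#
  ι-reflects-≈0 {a} ιa≈0 with a ≟ꟳ FF.0#
  ... | yes a≈0 = a≈0
  ... | no a≉0 with Field.inverse F a a≉0
  ...   | b , ab≈1 = ⊥-elim (Field.1≉0 K (begin
    1#             ≈⟨ ιʰ.1#-homo ⟨
    ι FF.1#        ≈⟨ ιʰ.⟦⟧-cong (FF.sym ab≈1) ⟩
    ι (a FF.* b)   ≈⟨ ιʰ.*-homo a b ⟩
    ι a * ι b      ≈⟨ *-congʳ ιa≈0 ⟩
    0# * ι b       ≈⟨ zeroˡ (ι b) ⟩
    0#             ∎))

  affine⇒ι≉0 : ∀ {v} → Affine v → ¬ ι (v (# 6)) ≈ 0#
  affine⇒ι≉0 {v} v-affine ιv₆≈0 = v-affine (ι-reflects-≈0 ιv₆≈0)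

  quadratic-congʳ : ∀ {a₀ a₁ a₂ x y} → x ≈ y → quadratic a₀ a₁ a₂ x ≈ quadratic a₀ a₁ a₂ y
  quadratic-congʳ x≈y = +-congˡ (+-cong (*-congˡ x≈y) (*-congˡ (*-cong x≈y x≈y)))

  σ-quadratic : ∀ a₀ a₁ a₂ x → σ (quadratic (ι a₀) (ι a₁) (ι a₂) x) ≈ quadratic (ι a₀) (ι a₁) (ι a₂) (σ x)
  σ-quadratic a₀ a₁ a₂ x = begin
    σ (ι a₀ + (ι a₁ * x + ι a₂ * (x * x)))           ≈⟨ σʰ.+-homo _ _ ⟩
    σ (ι a₀) + σ (ι a₁ * x + ι a₂ * (x * x))         ≈⟨ +-cong (σ-fixes-ι a₀) (σʰ.+-homo _ _) ⟩
    ι a₀ + (σ (ι a₁ * x) + σ (ι a₂ * (x * x)))       ≈⟨ +-congˡ (+-cong (σʰ.*-homo _ _) (σʰ.*-homo _ _)) ⟩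
    ι a₀ + (σ (ι a₁) * σ x + σ (ι a₂) * σ (x * x))   ≈⟨ +-congˡ (+-cong (*-congʳ (σ-fixes-ι a₁))
                                                          (*-cong (σ-fixes-ι a₂) (σʰ.*-homo x x))) ⟩
    ι a₀ + (ι a₁ * σ x + ι a₂ * (σ x * σ x))         ∎

  σ-orbit₀₂ : ∀ {x} → x ≈ σ (σ x) → σ x ≈ x
  σ-orbit₀₂ {x} x≈σ²x = trans (σ-cong x≈σ²x) (σ³≈id x)

  σ-orbit₁₂ : ∀ {x} → σ x ≈ σ (σ x) → σ x ≈ x
  σ-orbit₁₂ {x} σx≈σ²x = begin
    σ x               ≈⟨ σ-cong (σ³≈id x) ⟨
    σ (σ (σ (σ x)))   ≈⟨ σ-cong (σ-cong σx≈σ²x) ⟨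
    σ (σ (σ x))       ≈⟨ σ³≈id x ⟩
    x                 ∎

  τ₁ τ₂ : Carrier
  τ₁ = σ τ
  τ₂ = σ τ₁

  τ₁≉τ : ¬ τ₁ ≈ τ
  τ₁≉τ τ₁≈τ with proj₁ (proj₂ (proj₂ σ-automorphism))
  ... | x , σx≉x with proj₂ τ-basis x
  ...   | a₀ , a₁ , a₂ , θ⁻¹a≈x = σx≉x (begin
    σ x                                 ≈⟨ σ-cong θ⁻¹a≈x ⟨
    σ (θ⁻¹ a₀ a₁ a₂)                    ≈⟨ σ-quadratic a₀ a₁ a₂ τ ⟩
    quadratic (ι a₀) (ι a₁) (ι a₂) τ₁   ≈⟨ quadratic-congʳ τ₁≈τ ⟩
    θ⁻¹ a₀ a₁ a₂                        ≈⟨ θ⁻¹a≈x ⟩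
    x                                   ∎)

  τ₂≉τ : ¬ τ₂ ≈ τ
  τ₂≉τ τ₂≈τ = τ₁≉τ (σ-orbit₀₂ (sym τ₂≈τ))

  τ₂≉τ₁ : ¬ τ₂ ≈ τ₁
  τ₂≉τ₁ τ₂≈τ₁ = τ₁≉τ (σ-orbit₁₂ (sym τ₂≈τ₁))

  σ-fixed-θ⁻¹ : ∀ {a₀ a₁ a₂} → σ (θ⁻¹ a₀ a₁ a₂) ≈ θ⁻¹ a₀ a₁ a₂ → a₁ FF.≈ FF.0# × a₂ FF.≈ FF.0#
  σ-fixed-θ⁻¹ {a₀} {a₁} {a₂} fixed = ι-reflects-≈0 (proj₁ ιa≈0) , ι-reflects-≈0 (proj₂ ιa≈0)
    where
    p₁≈p₀ : quadratic (ι a₀) (ι a₁) (ι a₂) τ₁ ≈ θ⁻¹ a₀ a₁ a₂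
    p₁≈p₀ = trans (sym (σ-quadratic a₀ a₁ a₂ τ)) fixed
    p₂≈p₀ : quadratic (ι a₀) (ι a₁) (ι a₂) τ₂ ≈ θ⁻¹ a₀ a₁ a₂
    p₂≈p₀ = trans (sym (σ-quadratic a₀ a₁ a₂ τ₁)) (trans (σ-cong p₁≈p₀) fixed)
    ιa≈0 : ι a₁ ≈ 0# × ι a₂ ≈ 0#
    ιa≈0 = quadratic-constant {ι a₀} {ι a₁} {ι a₂} {τ} {τ₁} {τ₂} τ₁≉τ τ₂≉τ τ₂≉τ₁ p₁≈p₀ p₂≈p₀

  σ-fixed⇒InFixedPlane : ∀ v → σ (bb v (# 0)) ≈ bb v (# 0) → σ (bb v (# 1)) ≈ bb v (# 1) → InFixedPlane v
  σ-fixed⇒InFixedPlane v X-fixed Y-fixed = record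
    { x₁≈0 = proj₁ X-coefficients≈0 ; x₂≈0 = proj₂ X-coefficients≈0
    ; x₄≈0 = proj₁ Y-coefficients≈0 ; x₅≈0 = proj₂ Y-coefficients≈0 }
    where
    X-coefficients≈0 = σ-fixed-θ⁻¹ {v (# 0)} {v (# 1)} {v (# 2)} X-fixed
    Y-coefficients≈0 = σ-fixed-θ⁻¹ {v (# 3)} {v (# 4)} {v (# 5)} Y-fixed

  InFixedPlane⇒TypeI : ∀ {v} → InFixedPlane v → TypeI (bb v)
  InFixedPlane⇒TypeI {v} fixed = (v (# 0) ∷ v (# 3) ∷ v (# 6) ∷ []) , 1# , Field.1≉0 K , bb≈ιw
    where
    open InFixedPlane fixed
    bb≈ιw : ∀ i → bb v i ≈ 1# * ι ((v (# 0) ∷ v (# 3) ∷ v (# 6) ∷ []) i)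
    bb≈ιw zero =
      trans (quadratic≈constant τ (ι-preserves-≈0 x₁≈0) (ι-preserves-≈0 x₂≈0)) (sym (*-identityˡ _))
    bb≈ιw (suc zero) =
      trans (quadratic≈constant τ (ι-preserves-≈0 x₄≈0) (ι-preserves-≈0 x₅≈0)) (sym (*-identityˡ _))
    bb≈ιw (suc (suc zero)) = sym (*-identityˡ _)

  σ-fixed-factor : ∀ {c y} → ¬ y ≈ 0# → σ y ≈ y → σ (c * y) ≈ c * y → σ c ≈ c
  σ-fixed-factor {c} {y} y≉0 y-fixed cy-fixed = x-y≈0⇒x≈y (σ c) c (*-cancelˡ-≈0 y≉0 (begin
    y * (σ c - c)       ≈⟨ x[y-z]≈xy-xz y (σ c) c ⟩
    y * σ c - y * c     ≈⟨ +-cong (*-comm y (σ c)) (-‿cong (*-comm y c)) ⟩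
    σ c * y - c * y     ≈⟨ +-congʳ (trans (*-congˡ (sym y-fixed)) (sym (σʰ.*-homo c y))) ⟩
    σ (c * y) - c * y   ≈⟨ x≈y⇒x-y≈0 cy-fixed ⟩
    0#                  ∎))

  TypeI⇒InFixedPlane : ∀ {v} → Affine v → TypeI (bb v) → InFixedPlane v
  TypeI⇒InFixedPlane {v} v-affine (w , c , _ , bb≈cιw) = σ-fixed⇒InFixedPlane v (fixed (# 0)) (fixed (# 1))
    where
    ιw₂≉0 : ¬ ι (w (# 2)) ≈ 0#
    ιw₂≉0 ιw₂≈0 = affine⇒ι≉0 {v} v-affine (trans (bb≈cιw (# 2)) (trans (*-congˡ ιw₂≈0) (zeroʳ c)))
    c-fixed : σ c ≈ c
    c-fixed = σ-fixed-factor ιw₂≉0 (σ-fixes-ι (w (# 2)))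
      (trans (σ-cong (sym (bb≈cιw (# 2)))) (trans (σ-fixes-ι (v (# 6))) (bb≈cιw (# 2))))
    fixed : ∀ i → σ (bb v i) ≈ bb v i
    fixed i = begin
      σ (bb v i)          ≈⟨ σ-cong (bb≈cιw i) ⟩
      σ (c * ι (w i))     ≈⟨ σʰ.*-homo c (ι (w i)) ⟩
      σ c * σ (ι (w i))   ≈⟨ *-cong c-fixed (σ-fixes-ι (w i)) ⟩
      c * ι (w i)         ≈⟨ bb≈cιw i ⟨
      bb v i              ∎

  row : FF.Vect 7 → Carrier → Vect 3
  row v x = quadratic (ι (v (# 0))) (ι (v (# 1))) (ι (v (# 2))) x
          ∷ quadratic (ι (v (# 3))) (ι (v (# 4))) (ι (v (# 5))) x
          ∷ ι (v (# 6)) ∷ []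

  bb≈row : ∀ v → bb v ≈v row v τ
  bb≈row v zero             = refl
  bb≈row v (suc zero)       = refl
  bb≈row v (suc (suc zero)) = refl

  φ-cong : ∀ {u w} → u ≈v w → φ u ≈v φ w
  φ-cong u≈w i = σ-cong (u≈w i)

  φ-row : ∀ v x → φ (row v x) ≈v row v (σ x)
  φ-row v x zero             = σ-quadratic _ _ _ x
  φ-row v x (suc zero)       = σ-quadratic _ _ _ x
  φ-row v x (suc (suc zero)) = σ-fixes-ι _

  ι-quadric : ∀ v → ι (quadric v) ≈ ι (v (# 1)) * ι (v (# 5)) - ι (v (# 2)) * ι (v (# 4))
  ι-quadric v = begin
    ι (x₁x₅ FF.- x₂x₄)       ≈⟨ ιʰ.+-homo x₁x₅ (FF.- x₂x₄) ⟩
    ι x₁x₅ + ι (FF.- x₂x₄)   ≈⟨ +-cong (ιʰ.*-homo _ _) (trans (ιʰ.-‿homo x₂x₄) (-‿cong (ιʰ.*-homo _ _))) ⟩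
    ι (v (# 1)) * ι (v (# 5)) - ι (v (# 2)) * ι (v (# 4))   ∎
    where
    x₁x₅ = v (# 1) FF.* v (# 5)
    x₂x₄ = v (# 2) FF.* v (# 4)

  β : Carrier
  β = (τ₁ - τ) * (τ₂ - τ) * (τ₂ - τ₁)

  β≉0 : ¬ β ≈ 0#
  β≉0 = *-≉0 (*-≉0 (difference≉0 τ₁≉τ) (difference≉0 τ₂≉τ)) (difference≉0 τ₂≉τ₁)
    where
    difference≉0 : ∀ {x y} → ¬ x ≈ y → ¬ x - y ≈ 0#
    difference≉0 {x} {y} x≉y x-y≈0 = x≉y (x-y≈0⇒x≈y x y x-y≈0)

  det-orbit : ∀ v → det (bb v) (φ (bb v)) (φ (φ (bb v))) ≈ ι (v (# 6)) * β * ι (quadric v)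
  det-orbit v = begin
    det (bb v) (φ (bb v)) (φ (φ (bb v)))   ≈⟨ det-cong (bb≈row v) φbb≈row φφbb≈row ⟩
    det (row v τ) (row v τ₁) (row v τ₂)    ≈⟨ det-quadratic-rows (ι (v (# 0))) (ι (v (# 1))) (ι (v (# 2)))
                                                (ι (v (# 3))) (ι (v (# 4))) (ι (v (# 5))) (ι (v (# 6))) τ τ₁ τ₂ ⟩
    ι (v (# 6)) * β * (ι (v (# 1)) * ι (v (# 5)) - ι (v (# 2)) * ι (v (# 4)))   ≈⟨ *-congˡ (ι-quadric v) ⟨
    ι (v (# 6)) * β * ι (quadric v)        ∎
    where
    φbb≈row : φ (bb v) ≈v row v τ₁
    φbb≈row i = trans (φ-cong (bb≈row v) i) (φ-row v τ i)
    φφbb≈row : φ (φ (bb v)) ≈v row v τ₂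
    φφbb≈row i = trans (φ-cong φbb≈row i) (φ-row v τ₁ i)

  orbit-distinct : ∀ {v} → Affine v → ¬ InFixedPlane v → Distinct3 (bb v) (φ (bb v)) (φ (φ (bb v)))
  orbit-distinct {v} v-affine v∉plane =
    no-collision id σ sym refl σ-fixes-ι₆ ,
    no-collision id (σ ∘ σ) σ-orbit₀₂ refl σ²-fixes-ι₆ ,
    no-collision σ (σ ∘ σ) σ-orbit₁₂ σ-fixes-ι₆ σ²-fixes-ι₆
    where
    σ-fixes-ι₆ = σ-fixes-ι (v (# 6))
    σ²-fixes-ι₆ = trans (σ-cong σ-fixes-ι₆) σ-fixes-ι₆
    -- r and s select two of the three maps id, σ, σ² producing the orbit.
    no-collision : ∀ (r s : Carrier → Carrier) → (∀ {x} → r x ≈ s x → σ x ≈ x) →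
      r (ι (v (# 6))) ≈ ι (v (# 6)) → s (ι (v (# 6))) ≈ ι (v (# 6)) →
      ¬ SamePoint (λ i → r (bb v i)) (λ i → s (bb v i))
    no-collision r s r≈s⇒fixed r-last s-last same =
      v∉plane (σ-fixed⇒InFixedPlane v (r≈s⇒fixed (proj₁ XY-equal)) (r≈s⇒fixed (proj₂ XY-equal)))
      where XY-equal = SamePoint⇒affine-≈ (affine⇒ι≉0 {v} v-affine) r-last s-last same

  TypeII⇒quadric≈0 : ∀ {v} → Affine v → TypeII (bb v) → quadric v FF.≈ FF.0#
  TypeII⇒quadric≈0 {v} v-affine (_ , collinear) with quadric v ≟ꟳ FF.0#
  ... | yes quadric≈0 = quadric≈0
  ... | no quadric≉0  = ⊥-elim (det≉0⇒¬Collinear {bb v} {φ (bb v)} {φ (φ (bb v))} det≉0 collinear)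
    where
    det≉0 : ¬ det (bb v) (φ (bb v)) (φ (φ (bb v))) ≈ 0#
    det≉0 det≈0 = *-≉0 (*-≉0 (affine⇒ι≉0 {v} v-affine) β≉0) (λ ιQ≈0 → quadric≉0 (ι-reflects-≈0 ιQ≈0))
      (trans (sym (det-orbit v)) det≈0)

  quadric≈0⇒TypeII : ∀ {v} → Affine v → ¬ InFixedPlane v → quadric v FF.≈ FF.0# → TypeII (bb v)
  quadric≈0⇒TypeII {v} v-affine v∉plane quadric≈0 =
    orbit-distinct v-affine v∉plane ,
    det≈0⇒Collinear {bb v} {φ (bb v)} {φ (φ (bb v))} cross≉0
      (trans (det-orbit v) (trans (*-congˡ (ι-preserves-≈0 quadric≈0)) (zeroʳ _)))
    where
    cross≉0 : NonZero (cross (bb v) (φ (bb v)))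
    cross≉0 cross≈0 = v∉plane (σ-fixed⇒InFixedPlane v (sym (proj₁ XY-equal)) (sym (proj₂ XY-equal)))
      where
      XY-equal = cross≈0⇒affine-≈ {bb v} {φ (bb v)} (affine⇒ι≉0 {v} v-affine) refl (σ-fixes-ι (v (# 6))) cross≈0

  InFixedPlane? : ∀ v → Dec (InFixedPlane v)
  InFixedPlane? v with v (# 1) ≟ꟳ FF.0# | v (# 2) ≟ꟳ FF.0# | v (# 4) ≟ꟳ FF.0# | v (# 5) ≟ꟳ FF.0#
  ... | yes x₁≈0 | yes x₂≈0 | yes x₄≈0 | yes x₅≈0 =
    yes (record { x₁≈0 = x₁≈0 ; x₂≈0 = x₂≈0 ; x₄≈0 = x₄≈0 ; x₅≈0 = x₅≈0 })
  ... | no x₁≉0 | _       | _       | _       = no (x₁≉0 ∘ InFixedPlane.x₁≈0)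
  ... | yes _   | no x₂≉0 | _       | _       = no (x₂≉0 ∘ InFixedPlane.x₂≈0)
  ... | yes _   | yes _   | no x₄≉0 | _       = no (x₄≉0 ∘ InFixedPlane.x₄≈0)
  ... | yes _   | yes _   | yes _   | no x₅≉0 = no (x₅≉0 ∘ InFixedPlane.x₅≈0)

  I⊎II⇔hyperbolicForm≈0 : ∀ {v} → Affine v →
    (TypeI (bb v) ⊎ TypeII (bb v) → FF.evalQ hyperbolicForm v FF.≈ FF.0#) ×
    (FF.evalQ hyperbolicForm v FF.≈ FF.0# → TypeI (bb v) ⊎ TypeII (bb v))
  I⊎II⇔hyperbolicForm≈0 {v} v-affine =
    FF.trans (evalQ-hyperbolicForm v) ∘
      [ InFixedPlane⇒quadric≈0 ∘ TypeI⇒InFixedPlane v-affine , TypeII⇒quadric≈0 v-affine ] ,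
    λ Q≈0 → case InFixedPlane? v of λ where
      (yes fixed)  → inj₁ (InFixedPlane⇒TypeI fixed)
      (no v∉plane) → inj₂ (quadric≈0⇒TypeII v-affine v∉plane (FF.trans (FF.sym (evalQ-hyperbolicForm v)) Q≈0))

  -- A vertex vector at infinity is shifted by e₆, itself a type I point and hence in the span.
  vertex⊆InFixedPlane : (p : Fin 3 → FF.Vect 7) →
    (∀ v → Affine v → (FF.InSpan p v → TypeI (bb v)) × (TypeI (bb v) → FF.InSpan p v)) →
    ∀ j → InFixedPlane (p j)
  vertex⊆InFixedPlane p p-spans-I j with p j (# 6) ≟ꟳ FF.0#
  ... | no pⱼ-affine = TypeI⇒InFixedPlane pⱼ-affine (proj₁ (p-spans-I (p j) pⱼ-affine) (δ j , F-properties.comb-δ j p))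
  ... | yes pⱼ₆≈0    = unshift (TypeI⇒InFixedPlane u-affine (proj₁ (p-spans-I u u-affine) u∈p))
    where
    e₆ : FF.Vect 7
    e₆ = δ (# 6)
    e₆∈p : FF.InSpan p e₆
    e₆∈p = proj₂ (p-spans-I e₆ (Field.1≉0 F))
      (InFixedPlane⇒TypeI (record { x₁≈0 = FF.refl ; x₂≈0 = FF.refl ; x₄≈0 = FF.refl ; x₅≈0 = FF.refl }))
    u : FF.Vect 7
    u = p j FF.+v e₆
    u-affine : Affine u
    u-affine u₆≈0 = Field.1≉0 F (FF.trans (FF.sym (FF.+-identityˡ FF.1#)) (FF.trans (FF.+-congʳ (FF.sym pⱼ₆≈0)) u₆≈0))
    u∈p : FF.InSpan p u
    u∈p = (λ k → δ j k FF.+ proj₁ e₆∈p k) ,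
          λ i → FF.trans (F-properties.comb-+ (δ j) (proj₁ e₆∈p) p i)
                         (FF.+-cong (F-properties.comb-δ j p i) (proj₂ e₆∈p i))
    unshift : InFixedPlane u → InFixedPlane (p j)
    unshift fixed = record
      { x₁≈0 = FF.trans (FF.sym (FF.+-identityʳ _)) x₁≈0 ; x₂≈0 = FF.trans (FF.sym (FF.+-identityʳ _)) x₂≈0
      ; x₄≈0 = FF.trans (FF.sym (FF.+-identityʳ _)) x₄≈0 ; x₅≈0 = FF.trans (FF.sym (FF.+-identityʳ _)) x₅≈0 }
      where open InFixedPlane fixed

theorem25 : (q : ℕ) → IsPrimePower q → 2 < q →
    (F K : Field) → FieldOps.HasCard F q → FieldOps.HasCard K (q ^ 3) →
    (ι : FieldOps.Carrier F → FieldOps.Carrier K) →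
    (σ : FieldOps.Carrier K → FieldOps.Carrier K) →
    (τ : FieldOps.Carrier K) →
    let open Setup F K ι σ τ in
    IsEmbedding → IsOrder3AutFixingSubfield → IsTauBasis →
    (p : Fin 3 → FF.Vect 7) → FF.Independent p →
    (∀ v → Affine v → (FF.InSpan p v → TypeI (bb v)) × (TypeI (bb v) → FF.InSpan p v)) →
    ∃ λ (c : FF.QForm 7) →
      FF.ConeOverHyperbolic c p ×
      (∀ v → Affine v →
        ((TypeI (bb v) ⊎ TypeII (bb v)) → FF.evalQ c v FF.≈ FF.0#) ×
        (FF.evalQ c v FF.≈ FF.0# → TypeI (bb v) ⊎ TypeII (bb v)))
theorem25 _ _ _ F K F-finite _ ι σ τ ι-embedding σ-automorphism τ-basis p p-independent p-spans-I =
  hyperbolicForm ,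
  hyperbolic-cone p (vertex⊆InFixedPlane p p-spans-I) p-independent ,
  λ v → I⊎II⇔hyperbolicForm≈0
  where
  open Formulas (FieldOps.rawRing F) using (hyperbolicForm)
  open HyperbolicCone F using (hyperbolic-cone)
  open BruckBose F K ι σ τ (FieldProperties.HasCard⇒decidable F F-finite) ι-embedding σ-automorphism τ-basis
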